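{- For any fragment $\underline F$ of length $\ell>1$, we have $\mathcal W(\underline F^\tau)=\mathcal W(\underline F)^\tau$, where $\underline F^\tau$ is obtained from $\underline F$ by exchanging the letters $\mathbf A$ and $\mathbf B$ (every entry $\mathbf A$ becomes $\mathbf B$ and vice versa, $\mathbf{AB}$ and $\mathbf 0$ unchanged), and for $W\subset\{0,1\}^\ell$, $W^\tau=\{(1-w_0,w_1,\dots,w_{\ell-1}) : (w_0,\dots,w_{\ell-1})\in W\}$.
   Context: Fragments. A fragment of length $\ell\ge1$ is a tuple $\underline F=(F_0,\dots,F_{\ell-1})$ of pairs $F_i=(F_i^\uparrow,F_i^\downarrow)\in\{\mathbf{A},\mathbf{B},\mathbf{AB},\mathbf{0}\}^2$ (formal symbols) such that: exactly one of $F_0^\uparrow,F_0^\downarrow$ equals $\mathbf{0}$; for $i>0$, $F_i^\uparrow,F_i^\downarrow\ne\mathbf 0$; for $i<\ell-1$, $F_i^\uparrow,F_i^\downarrow\ne\mathbf{AB}$; if $\ell>1$, exactly one of $F_{\ell-1}^\uparrow,F_{\ell-1}^\downarrow$ equals $\mathbf{AB}$. Fragmentary weights. Let $\sim$ be the equivalence relation on symbols with classes $\{\mathbf{A},\mathbf{AB}\}$, $\{\mathbf{B},\mathbf{0}\}$; $W\times\{c\}$ appends $c$ to each tuple of $W$. Define $W_0^{(b,b)}=\emptyset$ if $\ell=1$ and ($F_0^\uparrow\in\{\mathbf A,\mathbf B\}$ or $F_0^\downarrow\in\{\mathbf A,\mathbf B\}$), else $\{(1)\}$; $W_0^{(a,b)}=\emptyset$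 if $F_0^\downarrow=\mathbf 0$, else $\{(0)\}$; $W_0^{(b,a)}=\emptyset$ if $F_0^\uparrow=\mathbf 0$, else $\{(0)\}$; for $1\le i\le\ell-1$: $W_i^{(b,b)}=(W_{i-1}^{(a,b)}\cup W_{i-1}^{(b,a)})\times\{1\}$ if $F_{i-1}^\uparrow\sim F_{i-1}^\downarrow$, else $W_{i-1}^{(b,b)}\times\{1\}$; $W_i^{(a,b)}=W_{i-1}^{(a,b)}\times\{0\}$ if $F_i^\uparrow\sim F_{i-1}^\uparrow$, else $(W_{i-1}^{(b,a)}\cup W_{i-1}^{(b,b)})\times\{0\}$; $W_i^{(b,a)}=W_{i-1}^{(b,a)}\times\{0\}$ if $F_i^\downarrow\sim F_{i-1}^\downarrow$, else $(W_{i-1}^{(a,b)}\cup W_{i-1}^{(b,b)})\times\{0\}$. Then $\mathcal W(\underline F)=W_{\ell-1}^{(b,b)}\cup W_{\ell-1}^{(a,b)}$ if $F_{\ell-1}^\downarrow=\mathbf{AB}$; $=W_{\ell-1}^{(b,b)}\cup W_{\ell-1}^{(b,a)}$ if $F_{\ell-1}^\uparrow=\mathbf{AB}$; $=W_0^{(b,b)}\cup W_0^{(a,b)}\cup W_0^{(b,a)}$ otherwise. -}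

module Defs where

open import Data.Bool using (Bool; true; false; not; if_then_else_; _∧_; _∨_)
open import Data.Bool.Properties using () renaming (_≟_ to _≟ᵇ_)
import Data.Vec
open import Data.Nat using (ℕ; zero; suc; _<_; _≟_)
open import Data.Fin using (Fin; toℕ)
open import Data.Product using (_×_; _,_; proj₁; proj₂)
open import Data.Sum using (_⊎_)
open import Data.List using (List; []; _∷_; _++_; map)
open import Data.Vec using (Vec; []; _∷_; _∷ʳ_; head; lookup; reverse)
open import Relation.Nullary using (¬_; does)
open import Relation.Binary.PropositionalEquality using (_≡_; _≢_)

data Sym : Set where
  A B AB O : Sym

-- a position F_i = (F_i^↑ , F_i^↓)
Pos : Set
Pos = Sym × Sym

ExactlyOne : {X : Set} → (X → Set) → X → X → Set
ExactlyOne P a b = (P a × ¬ P b) ⊎ (¬ P a × P b)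

record IsFragment {m : ℕ} (F : Vec Pos (suc m)) : Set where
  field
    first-zero : ExactlyOne (_≡ O) (proj₁ (head F)) (proj₂ (head F))
    no-zero    : (i : Fin (suc m)) → 0 < toℕ i →
                 proj₁ (lookup F i) ≢ O × proj₂ (lookup F i) ≢ O
    no-AB      : (i : Fin (suc m)) → toℕ i < m →
                 proj₁ (lookup F i) ≢ AB × proj₂ (lookup F i) ≢ AB
    last-AB    : 0 < m →
                 ExactlyOne (_≡ AB) (proj₁ (head (reverse F))) (proj₂ (head (reverse F)))

cls : Sym → Bool
cls A  = true
cls AB = true
cls B  = false
cls O  = false

sim : Sym → Sym → Bool
sim x y = does (cls x ≟ᵇ cls y)

isAorB : Sym → Bool
isAorB A = true
isAorB B = true
isAorB _ = false

isO : Sym → Bool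
isO O = true
isO _ = false

isAB : Sym → Bool
isAB AB = true
isAB _  = false

-- tuples in {0,1}^n, with 0 = false, 1 = true; finite sets of them as lists
Subs01 : ℕ → Set
Subs01 n = List (Vec Bool n)

_×c_ : {n : ℕ} → Subs01 n → Bool → Subs01 (suc n)
W ×c c = map (_∷ʳ c) W

record Triple (n : ℕ) : Set where
  constructor triple
  field
    bb ab ba : Subs01 n
open Triple public

W₀ : ℕ → Pos → Triple 1
W₀ ℓ (u , d) = triple
  (if does (ℓ ≟ 1) ∧ (isAorB u ∨ isAorB d) then [] else ((true ∷ []) ∷ []))
  (if isO d then [] else ((false ∷ []) ∷ []))
  (if isO u then [] else ((false ∷ []) ∷ []))

-- W_i computed from W_{i-1}, with Fᵢ = (u , d) and F_{i-1} = (u' , d')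
Wstep : {n : ℕ} → Pos → Pos → Triple n → Triple (suc n)
Wstep (u , d) (u' , d') (triple bb ab ba) = triple
  ((if sim u' d' then ab ++ ba else bb) ×c true)
  ((if sim u u' then ab else ba ++ bb) ×c false)
  ((if sim d d' then ba else ab ++ bb) ×c false)

-- W_k for a reversed fragment prefix (head = F_k, last = F_0); ℓ is the full length
Wrev : ℕ → (k : ℕ) → Vec Pos (suc k) → Triple (suc k)
Wrev ℓ zero    (F₀ ∷ [])        = W₀ ℓ F₀
Wrev ℓ (suc k) (Fᵢ ∷ Fᵢ₋₁ ∷ Fs) = Wstep Fᵢ Fᵢ₋₁ (Wrev ℓ k (Fᵢ₋₁ ∷ Fs))

𝒲 : {m : ℕ} → Vec Pos (suc m) → Subs01 (suc m)
𝒲 {m} F =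
  let T  = Wrev (suc m) m (reverse F)
      u  = proj₁ (head (reverse F))
      d  = proj₂ (head (reverse F))
  in if isAB d then bb T ++ ab T else
     if isAB u then bb T ++ ba T else
     otherwise m F
  where
    -- "otherwise": W_0^(b,b) ∪ W_0^(a,b) ∪ W_0^(b,a).  For a fragment this case only
    -- arises when ℓ = 1; for ℓ > 1 it is unreachable on fragments (value [] is a dummy).
    otherwise : (m : ℕ) → Vec Pos (suc m) → Subs01 (suc m)
    otherwise zero    F = let T₀ = W₀ 1 (head F) in bb T₀ ++ ab T₀ ++ ba T₀
    otherwise (suc _) _ = []

swapAB : Sym → Sym
swapAB A = B
swapAB B = A
swapAB x = x

τF : {ℓ : ℕ} → Vec Pos ℓ → Vec Pos ℓ
τF = Data.Vec.map (λ { (u , d) → (swapAB u , swapAB d) })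

τw : {n : ℕ} → Vec Bool (suc n) → Vec Bool (suc n)
τw (b ∷ w) = not b ∷ w

τW : {n : ℕ} → Subs01 (suc n) → Subs01 (suc n)
τW = map τw

-- Exchanging A and B preserves ∼ between two letters and leaves W₀ unchanged.  So once the
-- three sets W_i for F^τ are the τ-images of those for F, the same holds at step i + 1: both
-- recursions take the same branches, and τ commutes with × {c} and ∪.  The swap does change ∼
-- between a letter and 0 or AB.  At the first step F₀ contains a 0, and there the swap
-- exchanges the two branches of an if, whose values differ exactly in w₀; this step is checked
-- on the four possible F₀.  At the last step the AB entry only enters the component that 𝒲
-- discards.
module Submission where

open import Defs
open import Data.Nat using (ℕ; zero; suc; _<_; z≤n; s≤s)
open import Data.Vec using (Vec; []; _∷_; _∷ʳ_; head; lookup; reverse)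
open import Data.Bool using (Bool; true; false; if_then_else_)
open import Data.List.Membership.Propositional using (_∈_)
open import Function.Bundles using (_⇔_; mk⇔)

open import Data.Bool.Properties using () renaming (_≟_ to _≟ᵇ_)
open import Data.Empty using (⊥-elim)
open import Function.Base using (_∘_)
open import Data.Fin using (Fin; toℕ; fromℕ) renaming (zero to fzero; suc to fsuc)
open import Data.List using ([]; _∷_; _++_)
open import Data.List.Properties using (map-++)
open import Data.List.Relation.Binary.BagAndSetEquality using (_∼[_]_; set; ++-cong; map-cong)
import Data.List.Relation.Binary.Subset.DecPropositional as DecSubset
open import Data.Product using (_×_; _,_; proj₁; proj₂; ∃₂)
open import Data.Sum using (inj₁; inj₂)
open import Data.Vec.Properties using (≡-dec; reverse-∷; map-reverse)
open import Data.Vec.Relation.Unary.All using (All; []; _∷_)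
open import Relation.Nullary.Decidable using (True; toWitness)
open import Relation.Binary.PropositionalEquality
  using (_≡_; _≢_; refl; sym; trans; cong; subst; subst₂)

data IsLetter : Sym → Set where
  A-letter : IsLetter A
  B-letter : IsLetter B

Letters : Pos → Set
Letters (u , d) = IsLetter u × IsLetter d

data Start : Pos → Set where
  O-top    : {x : Sym} → IsLetter x → Start (O , x)
  O-bottom : {x : Sym} → IsLetter x → Start (x , O)

data Final : Pos → Set where
  AB-top    : {x : Sym} → IsLetter x → Final (AB , x)
  AB-bottom : {x : Sym} → IsLetter x → Final (x , AB)

isLetter : {x : Sym} → x ≢ O → x ≢ AB → IsLetter x
isLetter {A}  _   _    = A-letter
isLetter {B}  _   _    = B-letter
isLetter {AB} _   x≢AB = ⊥-elim (x≢AB refl)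
isLetter {O}  x≢O _    = ⊥-elim (x≢O refl)

ZeroFree : Pos → Set
ZeroFree (u , d) = u ≢ O × d ≢ O

letters : {u d : Sym} → ZeroFree (u , d) → u ≢ AB × d ≢ AB → Letters (u , d)
letters (u≢O , d≢O) (u≢AB , d≢AB) = isLetter u≢O u≢AB , isLetter d≢O d≢AB

start : {u d : Sym} → ExactlyOne (_≡ O) u d → u ≢ AB × d ≢ AB → Start (u , d)
start (inj₁ (refl , d≢O)) (_ , d≢AB) = O-top (isLetter d≢O d≢AB)
start (inj₂ (u≢O , refl)) (u≢AB , _) = O-bottom (isLetter u≢O u≢AB)

final : {u d : Sym} → ExactlyOne (_≡ AB) u d → ZeroFree (u , d) → Final (u , d)
final (inj₁ (refl , d≢AB)) (_ , d≢O) = AB-top (isLetter d≢O d≢AB)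
final (inj₂ (u≢AB , refl)) (u≢O , _) = AB-bottom (isLetter u≢O u≢AB)

sim-swapAB : {x y : Sym} → IsLetter x → IsLetter y → sim (swapAB x) (swapAB y) ≡ sim x y
sim-swapAB A-letter A-letter = refl
sim-swapAB A-letter B-letter = refl
sim-swapAB B-letter A-letter = refl
sim-swapAB B-letter B-letter = refl

infix 4 _≈τ_ _≈τ₃_

-- Only as sets: the orders of the two lists differ in general.
_≈τ_ : {n : ℕ} → Subs01 (suc n) → Subs01 (suc n) → Set
S′ ≈τ S = S′ ∼[ set ] τW S

record _≈τ₃_ {n : ℕ} (T′ T : Triple (suc n)) : Set where
  field
    bb≈ : bb T′ ≈τ bb T
    ab≈ : ab T′ ≈τ ab T
    ba≈ : ba T′ ≈τ ba T
open _≈τ₃_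

τW-×c : {n : ℕ} (S : Subs01 (suc n)) (c : Bool) → τW (S ×c c) ≡ τW S ×c c
τW-×c []            c = refl
τW-×c ((b ∷ v) ∷ S) c = cong (_ ∷_) (τW-×c S c)

≈τ-×c : {n : ℕ} {S′ S : Subs01 (suc n)} (c : Bool) → S′ ≈τ S → S′ ×c c ≈τ S ×c c
≈τ-×c {S = S} c S′≈S =
  subst (_ ∼[ set ]_) (sym (τW-×c S c)) (map-cong (λ _ → refl) S′≈S)

≈τ-++ : {n : ℕ} {S′ S R′ R : Subs01 (suc n)} → S′ ≈τ S → R′ ≈τ R → S′ ++ R′ ≈τ S ++ R
≈τ-++ {S = S} {R = R} S′≈S R′≈R =
  subst (_ ∼[ set ]_) (sym (map-++ τw S R)) (++-cong S′≈S R′≈R)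

≈τ-if : {n : ℕ} {b′ b : Bool} {S′ S R′ R : Subs01 (suc n)} → b′ ≡ b → S′ ≈τ S → R′ ≈τ R →
        (if b′ then S′ else R′) ≈τ (if b then S else R)
≈τ-if {b = true}  refl S′≈S _    = S′≈S
≈τ-if {b = false} refl _    R′≈R = R′≈R

≈τ-by-computation : {n : ℕ} {S′ S : Subs01 (suc n)} →
  {⊆-yes : True (DecSubset._⊆?_ (≡-dec _≟ᵇ_) S′ (τW S))} →
  {⊇-yes : True (DecSubset._⊆?_ (≡-dec _≟ᵇ_) (τW S) S′)} → S′ ≈τ S
≈τ-by-computation {⊆-yes = ⊆-yes} {⊇-yes} = mk⇔ (toWitness ⊆-yes) (toWitness ⊇-yes)

τP : Pos → Pos
τP (u , d) = swapAB u , swapAB d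

module _ {n : ℕ} {T′ T : Triple (suc n)} (T′≈T : T′ ≈τ₃ T) where

  Wstep-bb-τ : {p q : Pos} → Letters q →
    bb (Wstep (τP p) (τP q) T′) ≈τ bb (Wstep p q T)
  Wstep-bb-τ (u′-letter , d′-letter) = ≈τ-×c true
    (≈τ-if (sim-swapAB u′-letter d′-letter) (≈τ-++ (ab≈ T′≈T) (ba≈ T′≈T)) (bb≈ T′≈T))

  Wstep-ab-τ : {u d : Sym} {q : Pos} → IsLetter u → IsLetter (proj₁ q) →
    ab (Wstep (τP (u , d)) (τP q) T′) ≈τ ab (Wstep (u , d) q T)
  Wstep-ab-τ u-letter u′-letter = ≈τ-×c false
    (≈τ-if (sim-swapAB u-letter u′-letter) (ab≈ T′≈T) (≈τ-++ (ba≈ T′≈T) (bb≈ T′≈T)))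

  Wstep-ba-τ : {u d : Sym} {q : Pos} → IsLetter d → IsLetter (proj₂ q) →
    ba (Wstep (τP (u , d)) (τP q) T′) ≈τ ba (Wstep (u , d) q T)
  Wstep-ba-τ d-letter d′-letter = ≈τ-×c false
    (≈τ-if (sim-swapAB d-letter d′-letter) (ba≈ T′≈T) (≈τ-++ (ab≈ T′≈T) (bb≈ T′≈T)))

module _ {n : ℕ} {s : Pos} where

  private
    ℓ = suc (suc n)

  first-bb-τ : {p : Pos} → Start s → bb (Wstep (τP p) (τP s) (W₀ ℓ (τP s))) ≈τ bb (Wstep p s (W₀ ℓ s))
  first-bb-τ (O-top    A-letter) = ≈τ-by-computation
  first-bb-τ (O-top    B-letter) = ≈τ-by-computation
  first-bb-τ (O-bottom A-letter) = ≈τ-by-computation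
  first-bb-τ (O-bottom B-letter) = ≈τ-by-computation

  first-ab-τ : {u d : Sym} → IsLetter u → Start s →
    ab (Wstep (τP (u , d)) (τP s) (W₀ ℓ (τP s))) ≈τ ab (Wstep (u , d) s (W₀ ℓ s))
  first-ab-τ A-letter (O-top    A-letter) = ≈τ-by-computation
  first-ab-τ A-letter (O-top    B-letter) = ≈τ-by-computation
  first-ab-τ A-letter (O-bottom A-letter) = ≈τ-by-computation
  first-ab-τ A-letter (O-bottom B-letter) = ≈τ-by-computation
  first-ab-τ B-letter (O-top    A-letter) = ≈τ-by-computation
  first-ab-τ B-letter (O-top    B-letter) = ≈τ-by-computation
  first-ab-τ B-letter (O-bottom A-letter) = ≈τ-by-computation
  first-ab-τ B-letter (O-bottom B-letter) = ≈τ-by-computation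

  first-ba-τ : {u d : Sym} → IsLetter d → Start s →
    ba (Wstep (τP (u , d)) (τP s) (W₀ ℓ (τP s))) ≈τ ba (Wstep (u , d) s (W₀ ℓ s))
  first-ba-τ A-letter (O-top    A-letter) = ≈τ-by-computation
  first-ba-τ A-letter (O-top    B-letter) = ≈τ-by-computation
  first-ba-τ A-letter (O-bottom A-letter) = ≈τ-by-computation
  first-ba-τ A-letter (O-bottom B-letter) = ≈τ-by-computation
  first-ba-τ B-letter (O-top    A-letter) = ≈τ-by-computation
  first-ba-τ B-letter (O-top    B-letter) = ≈τ-by-computation
  first-ba-τ B-letter (O-bottom A-letter) = ≈τ-by-computation
  first-ba-τ B-letter (O-bottom B-letter) = ≈τ-by-computation

module _ {n : ℕ} {s : Pos} (s-start : Start s) where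

  private
    Wʳ : {k : ℕ} → Vec Pos (suc (suc k)) → Triple (suc (suc k))
    Wʳ {k} = Wrev (suc (suc n)) (suc k)

  mutual
    Wrev-τ : {k : ℕ} {p : Pos} {M : Vec Pos k} → Letters p → All Letters M →
      Wʳ (τF (p ∷ (M ∷ʳ s))) ≈τ₃ Wʳ (p ∷ (M ∷ʳ s))
    Wrev-τ (u-letter , d-letter) M-letters = record
      { bb≈ = Wrev-bb-τ M-letters
      ; ab≈ = Wrev-ab-τ u-letter M-letters
      ; ba≈ = Wrev-ba-τ d-letter M-letters
      }

    Wrev-bb-τ : {k : ℕ} {p : Pos} {M : Vec Pos k} → All Letters M →
      bb (Wʳ (τF (p ∷ (M ∷ʳ s)))) ≈τ bb (Wʳ (p ∷ (M ∷ʳ s)))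
    Wrev-bb-τ {p = p} [] = first-bb-τ {n} {p = p} s-start
    Wrev-bb-τ {p = p} {M = q ∷ _} (q-letters ∷ M-letters) =
      Wstep-bb-τ (Wrev-τ {p = q} q-letters M-letters) {p} q-letters

    Wrev-ab-τ : {k : ℕ} {u d : Sym} {M : Vec Pos k} → IsLetter u → All Letters M →
      ab (Wʳ (τF ((u , d) ∷ (M ∷ʳ s)))) ≈τ ab (Wʳ ((u , d) ∷ (M ∷ʳ s)))
    Wrev-ab-τ {d = d} u-letter [] = first-ab-τ {n} {d = d} u-letter s-start
    Wrev-ab-τ {d = d} {M = q ∷ _} u-letter (q-letters@(u′ , _) ∷ M-letters) =
      Wstep-ab-τ (Wrev-τ {p = q} q-letters M-letters) {d = d} {q = q} u-letter u′

    Wrev-ba-τ : {k : ℕ} {u d : Sym} {M : Vec Pos k} → IsLetter d → All Letters M →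
      ba (Wʳ (τF ((u , d) ∷ (M ∷ʳ s)))) ≈τ ba (Wʳ ((u , d) ∷ (M ∷ʳ s)))
    Wrev-ba-τ {u = u} d-letter [] = first-ba-τ {n} {u = u} d-letter s-start
    Wrev-ba-τ {u = u} {M = q ∷ _} d-letter (q-letters@(_ , d′) ∷ M-letters) =
      Wstep-ba-τ (Wrev-τ {p = q} q-letters M-letters) {u = u} {q = q} d-letter d′

𝒲ʳ : {j : ℕ} → Vec Pos (suc (suc j)) → Subs01 (suc (suc j))
𝒲ʳ {j} G =
  let T = Wrev (suc (suc j)) (suc j) G
      u = proj₁ (head G)
      d = proj₂ (head G)
  in if isAB d then bb T ++ ab T else if isAB u then bb T ++ ba T else []

𝒲≡𝒲ʳ∘reverse : {j : ℕ} (F : Vec Pos (suc (suc j))) → 𝒲 F ≡ 𝒲ʳ (reverse F)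
𝒲≡𝒲ʳ∘reverse F = refl

𝒲ʳ-τ : {j : ℕ} {z s : Pos} {M : Vec Pos j} → Final z → All Letters M → Start s →
  𝒲ʳ (τF (z ∷ (M ∷ʳ s))) ≈τ 𝒲ʳ (z ∷ (M ∷ʳ s))
𝒲ʳ-τ (AB-top A-letter) M-letters s-start =
  ≈τ-++ (Wrev-bb-τ s-start M-letters) (Wrev-ba-τ s-start A-letter M-letters)
𝒲ʳ-τ (AB-top B-letter) M-letters s-start =
  ≈τ-++ (Wrev-bb-τ s-start M-letters) (Wrev-ba-τ s-start B-letter M-letters)
𝒲ʳ-τ (AB-bottom u-letter) M-letters s-start =
  ≈τ-++ (Wrev-bb-τ s-start M-letters) (Wrev-ab-τ s-start u-letter M-letters)

All-∷ʳ⁺ : {X : Set} {P : X → Set} {k : ℕ} {xs : Vec X k} {x : X} → All P xs → P x → All P (xs ∷ʳ x)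
All-∷ʳ⁺ []         px = px ∷ []
All-∷ʳ⁺ (py ∷ pxs) px = py ∷ All-∷ʳ⁺ pxs px

reverse-split : {X : Set} {P Q : X → Set} {k : ℕ} (xs : Vec X (suc k)) →
  ((i : Fin (suc k)) → toℕ i < k → P (lookup xs i)) → Q (lookup xs (fromℕ k)) →
  ∃₂ λ z ys → reverse xs ≡ z ∷ ys × All P ys × Q z
reverse-split {k = zero} (x ∷ []) _ Q-last = x , [] , refl , [] , Q-last
reverse-split {P = P} {Q} {suc k} (x ∷ xs) P-init Q-last =
  let z , ys , rev≡ , P-ys , Q-z = reverse-split {P = P} {Q} xs (λ i → P-init (fsuc i) ∘ s≤s) Q-last
  in  z , ys ∷ʳ x
      , trans (reverse-∷ x xs) (cong (_∷ʳ x) rev≡)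
      , All-∷ʳ⁺ P-ys (P-init fzero (s≤s z≤n))
      , Q-z

fragment-shape : {j : ℕ} {F : Vec Pos (suc (suc j))} → IsFragment F →
  ∃₂ λ z M → ∃₂ λ s (_ : reverse F ≡ z ∷ (M ∷ʳ s)) → Final z × All Letters M × Start s
fragment-shape {j} {s ∷ N} frag =
  let z , M , revN≡ , M-letters , z-zero-free = reverse-split {P = Letters} {ZeroFree} N
        (λ i i<j → letters (no-zero (fsuc i) (s≤s z≤n)) (no-AB (fsuc i) (s≤s i<j)))
        (no-zero (fsuc (fromℕ j)) (s≤s z≤n))
      revF≡ = trans (reverse-∷ s N) (cong (_∷ʳ s) revN≡)
      z-one-AB = subst (λ p → ExactlyOne (_≡ AB) (proj₁ p) (proj₂ p)) (cong head revF≡) (last-AB (s≤s z≤n))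
  in  z , M , s , revF≡ , final z-one-AB z-zero-free , M-letters , start first-zero (no-AB fzero (s≤s z≤n))
  where open IsFragment frag

𝒲-τ : {j : ℕ} {F : Vec Pos (suc (suc j))} → IsFragment F → 𝒲 (τF F) ≈τ 𝒲 F
𝒲-τ {F = F} frag with fragment-shape frag
... | z , M , s , revF≡ , z-final , M-letters , s-start =
  subst₂ _≈τ_ (sym 𝒲[τF]≡) (sym 𝒲[F]≡) (𝒲ʳ-τ z-final M-letters s-start)
  where
    𝒲[F]≡ : 𝒲 F ≡ 𝒲ʳ (z ∷ (M ∷ʳ s))
    𝒲[F]≡ = trans (𝒲≡𝒲ʳ∘reverse F) (cong 𝒲ʳ revF≡)

    𝒲[τF]≡ : 𝒲 (τF F) ≡ 𝒲ʳ (τF (z ∷ (M ∷ʳ s)))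
    𝒲[τF]≡ = trans (𝒲≡𝒲ʳ∘reverse (τF F)) (cong 𝒲ʳ (trans (sym (map-reverse _ F)) (cong τF revF≡)))

lemma3p2p3 : (m : ℕ) → 0 < m → (F : Vec Pos (suc m)) → IsFragment F →
    (w : Vec Bool (suc m)) → (w ∈ 𝒲 (τF F)) ⇔ (w ∈ τW (𝒲 F))
lemma3p2p3 (suc _) _ _ frag _ = 𝒲-τ frag
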